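{- Let $\langle A,\vee\rangle$ be a join-semilattice, let $c\in A$, and let $I_1,I_2$ be subsemilattices of $A$ (subsets closed under $\vee$) such that $A = I_1\oplus_c I_2$. Then the ternary relation $\phi_c(x_1,x_2,x)$ (for $x_1\in I_1$, $x_2\in I_2$, $x\in A$) is the graph of a function $\langle x_1,x_2\rangle\mapsto x$ from $I_1\times I_2$ to $A$, and this function is an isomorphism of join-semilattices between the direct product $I_1\times I_2$ and $A$.
   Context: A join-semilattice $\langle A,\vee\rangle$ is a set with an idempotent, commutative, associative binary operation $\vee$; it is ordered by $a\le b$ iff $a\vee b=b$, and $a\vee b$ is the supremum of $\{a,b\}$. The partial operation $a\wedge b$ denotes the infimum of $\{a,b\}$ when it exists. Convention: a formula "$x\wedge y = z$" means "the infimum of $\{x,y\}$ exists and equals $z$"; more generally any equation $t_1=t_2$ involving $\wedge$ means "if either side exists, then the other also exists and they are equal". For fixed $c\in A$, $\phi_c(x_1,x_2,x)$ is the conjunction of: (dist) $x=(x\vee x_1)\wedge(x\vee x_2)$; (p1) $x_1=(x\vee x_1)\wedge(c\vee x_1)$; (p2) $x_2=(x\vee x_2)\wedge(c\vee x_2)$; (join) $x_1\vee x_2 = x\vee c$. For subsemilattices $I_1,I_2$ of $A$, $A$ is the $c$-direct sum of $I_1$ and $I_2$, written $A=I_1\oplus_c I_2$, iff all of the following hold: (Mod1) for all $x,y\in A$, $x_1\in I_1$, $x_2\in I_2$: if $x\vee c\ge x_1\vee x_2$ then $((x\vee x_1)\wedge(x\vee x_2))\vee y = (x\vee y\vee x_1)\wedge(x\vee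 y\vee x_2)$; (Mod2) for all $x,y\in A$, $x_1\in I_1$, $x_2\in I_2$: if $x\le x_1\vee x_2$ then $((x\vee x_i)\wedge(c\vee x_i))\vee y=(x\vee y\vee x_i)\wedge(c\vee y\vee x_i)$ for $i=1,2$; (Abs) for all $x_1,y_1\in I_1$ and $z_2\in I_2$: $x_1\wedge(y_1\vee z_2)=x_1\wedge(y_1\vee c)$, and likewise with the roles of $I_1$ and $I_2$ interchanged; (exi) for all $x_1\in I_1$, $x_2\in I_2$ there is $x\in A$ with $\phi_c(x_1,x_2,x)$; (onto) for all $x\in A$ there are $x_1\in I_1$, $x_2\in I_2$ with $\phi_c(x_1,x_2,x)$. -}

module Defs where

open import Level using (0ℓ)
open import Data.Product using (Σ; Σ-syntax; ∃; _×_; _,_; proj₁; proj₂)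
open import Relation.Binary.PropositionalEquality using (_≡_)
open import Function.Bundles using (_⇔_)
open import Algebra.Core using (Op₂)

module _ {A : Set} (_∨_ : Op₂ A) where

  _≤_ : A → A → Set
  a ≤ b = (a ∨ b) ≡ b

  IsInf : A → A → A → Set
  IsInf a b m = (m ≤ a) × (m ≤ b) × (∀ z → z ≤ a → z ≤ b → z ≤ m)

  -- Partial values: a predicate "the term is defined and has value v".
  PVal : Set₁
  PVal = A → Set

  ⌊_⌋ : A → PVal
  ⌊ a ⌋ v = a ≡ v

  _⊓_ : A → A → PVal
  (a ⊓ b) v = IsInf a b v

  _⊔ₚ_ : PVal → A → PVal
  (P ⊔ₚ y) v = Σ[ m ∈ A ] (P m × (m ∨ y) ≡ v)

  -- t₁ = t₂ in the convention of the paper: if either side exists, then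
  -- the other also exists and they are equal
  _≐_ : PVal → PVal → Set
  P ≐ Q = ∀ v → (P v → Q v) × (Q v → P v)

  IsSubsemilattice : (A → Set) → Set
  IsSubsemilattice I = ∀ {a b} → I a → I b → I (a ∨ b)

  module _ (c : A) where

    φ : A → A → A → Set
    φ x₁ x₂ x =
        (⌊ x ⌋ ≐ ((x ∨ x₁) ⊓ (x ∨ x₂)))
      × (⌊ x₁ ⌋ ≐ ((x ∨ x₁) ⊓ (c ∨ x₁)))
      × (⌊ x₂ ⌋ ≐ ((x ∨ x₂) ⊓ (c ∨ x₂)))
      × ((x₁ ∨ x₂) ≡ (x ∨ c))

    module _ (I₁ I₂ : A → Set) where

      Mod1 : Set
      Mod1 = ∀ x y x₁ x₂ → I₁ x₁ → I₂ x₂ → (x₁ ∨ x₂) ≤ (x ∨ c) →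
        (((x ∨ x₁) ⊓ (x ∨ x₂)) ⊔ₚ y) ≐ (((x ∨ y) ∨ x₁) ⊓ ((x ∨ y) ∨ x₂))

      Mod2 : Set
      Mod2 = ∀ x y x₁ x₂ → I₁ x₁ → I₂ x₂ → x ≤ (x₁ ∨ x₂) →
          ((((x ∨ x₁) ⊓ (c ∨ x₁)) ⊔ₚ y) ≐ (((x ∨ y) ∨ x₁) ⊓ ((c ∨ y) ∨ x₁)))
        × ((((x ∨ x₂) ⊓ (c ∨ x₂)) ⊔ₚ y) ≐ (((x ∨ y) ∨ x₂) ⊓ ((c ∨ y) ∨ x₂)))

      Abs : Set
      Abs = (∀ x₁ y₁ z₂ → I₁ x₁ → I₁ y₁ → I₂ z₂ →
                (x₁ ⊓ (y₁ ∨ z₂)) ≐ (x₁ ⊓ (y₁ ∨ c)))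
          × (∀ x₂ y₂ z₁ → I₂ x₂ → I₂ y₂ → I₁ z₁ →
                (x₂ ⊓ (y₂ ∨ z₁)) ≐ (x₂ ⊓ (y₂ ∨ c)))

      Exi : Set
      Exi = ∀ x₁ x₂ → I₁ x₁ → I₂ x₂ → Σ[ x ∈ A ] φ x₁ x₂ x

      Onto : Set
      Onto = ∀ x → Σ[ x₁ ∈ A ] Σ[ x₂ ∈ A ] (I₁ x₁ × I₂ x₂ × φ x₁ x₂ x)

      IsCDirectSum : Set
      IsCDirectSum = Mod1 × Mod2 × Abs × Exi × Onto

      Prod : Set
      Prod = Σ A I₁ × Σ A I₂

      _∨ᴾ_ : IsSubsemilattice I₁ → IsSubsemilattice I₂ → Prod → Prod → Prod
      (cl₁ ∨ᴾ cl₂) ((a₁ , p₁) , (a₂ , p₂)) ((b₁ , q₁) , (b₂ , q₂)) =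
        ((a₁ ∨ b₁) , cl₁ p₁ q₁) , ((a₂ ∨ b₂) , cl₂ p₂ q₂)

      _≈ᴾ_ : Prod → Prod → Set
      ((a₁ , _) , (a₂ , _)) ≈ᴾ ((b₁ , _) , (b₂ , _)) = (a₁ ≡ b₁) × (a₂ ≡ b₂)

      GraphOfIso : IsSubsemilattice I₁ → IsSubsemilattice I₂ → Set
      GraphOfIso cl₁ cl₂ = Σ[ f ∈ (Prod → A) ]
          (∀ (p : Prod) (x : A) →
             φ (proj₁ (proj₁ p)) (proj₁ (proj₂ p)) x ⇔ (f p ≡ x))
        × (∀ p q → f ((cl₁ ∨ᴾ cl₂) p q) ≡ (f p ∨ f q))
        × (∀ p q → f p ≡ f q → p ≈ᴾ q)
        × (∀ x → Σ[ p ∈ Prod ] f p ≡ x)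

-- Everything rests on two order properties of φ_c, for x₁, w₁ ∈ I₁ and
-- x₂, w₂ ∈ I₂ with φ(x₁,x₂,x) and φ(w₁,w₂,w).
-- Monotonicity: x₁ ≤ w₁ and x₂ ≤ w₂ imply x ≤ w. Since x ≤ w ∨ c, (Mod2)
-- applied to the meet (p1) with y = w puts x below x₁ ∨ w ≤ w₁ ∨ w, likewise
-- below w₂ ∨ w, and (dist) for w gives x ≤ w.
-- Reflection: x ≤ w implies x₁ ≤ w₁ and x₂ ≤ w₂. From x₁ ≤ w₁ ∨ w₂, (Abs)
-- gives x₁ ≤ w₁ ∨ c and then x₁ ≤ w₁ ∨ x₂; (Mod1) applied to the meet (dist)
-- with y = w ∨ w₁ gives x₁ ≤ w ∨ w₁, and (p1) for w gives x₁ ≤ w₁.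
-- Monotonicity makes φ_c functional, reflection makes it injective, (exi)
-- and (onto) make it total and surjective, and both properties together with
-- (onto) at x ∨ y show that it preserves joins.
module Submission where

open import Defs
open import Relation.Binary.PropositionalEquality using (_≡_; refl; sym; trans; subst; subst₂)
open import Algebra.Core using (Op₂)
open import Algebra.Lattice.Structures using (IsJoinSemilattice)
import Algebra.Lattice.Properties.Semilattice as SemilatticeProperties
import Relation.Binary.Lattice.Structures as OrderTheoretic
open import Data.Product using (Σ-syntax; _×_; _,_; proj₁; proj₂; swap)
open import Function.Bundles using (_⇔_; mk⇔)

module JoinSemilatticeOrder {A : Set} {_∨_ : Op₂ A}
  (L : IsJoinSemilattice _≡_ _∨_) where

  infix 4 _≼_
  _≼_ : A → A → Set
  _≼_ = _≤_ _∨_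

  open IsJoinSemilattice _≡_ L using (comm)

  -- The library's order on an algebraic semilattice is  x ⊑ y = (y ≡ y ∨ x),
  -- which agrees with  x ≼ y = (x ∨ y ≡ y)  up to commutativity.
  private
    _⊑_ : A → A → Set
    x ⊑ y = y ≡ y ∨ x

    ordered : OrderTheoretic.IsJoinSemilattice _≡_ _⊑_ _∨_
    ordered = SemilatticeProperties.∧-isOrderTheoreticJoinSemilattice
      (record { isSemilattice = L })

    module Ord = OrderTheoretic.IsJoinSemilattice ordered

    to : ∀ {x y} → x ≼ y → x ⊑ y
    to {x} {y} x≼y = sym (trans (comm y x) x≼y)

    from : ∀ {x y} → x ⊑ y → x ≼ y
    from {x} {y} y≡y∨x = trans (comm x y) (sym y≡y∨x)

  ≼-refl : ∀ {x} → x ≼ x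
  ≼-refl = from Ord.refl

  ≼-reflexive : ∀ {x y} → x ≡ y → x ≼ y
  ≼-reflexive refl = ≼-refl

  ≼-trans : ∀ {x y z} → x ≼ y → y ≼ z → x ≼ z
  ≼-trans x≼y y≼z = from (Ord.trans (to x≼y) (to y≼z))

  ≼-antisym : ∀ {x y} → x ≼ y → y ≼ x → x ≡ y
  ≼-antisym x≼y y≼x = Ord.antisym (to x≼y) (to y≼x)

  x≼x∨y : ∀ x y → x ≼ x ∨ y
  x≼x∨y x y = from (Ord.x≤x∨y x y)

  y≼x∨y : ∀ x y → y ≼ x ∨ y
  y≼x∨y x y = from (Ord.y≤x∨y x y)

  ∨-least : ∀ {x y z} → x ≼ z → y ≼ z → x ∨ y ≼ z
  ∨-least x≼z y≼z = from (Ord.∨-least (to x≼z) (to y≼z))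

  ∨-mono-≼ : ∀ {x y u v} → x ≼ u → y ≼ v → x ∨ y ≼ u ∨ v
  ∨-mono-≼ {u = u} {v} x≼u y≼v =
    ∨-least (≼-trans x≼u (x≼x∨y u v)) (≼-trans y≼v (y≼x∨y u v))

  ∨-comm-≼ : ∀ {x y z} → x ≼ y ∨ z → x ≼ z ∨ y
  ∨-comm-≼ {y = y} {z} = subst (_ ≼_) (comm y z)

  IsInf-comm : ∀ {a b m} → IsInf _∨_ a b m → IsInf _∨_ b a m
  IsInf-comm (m≼a , m≼b , greatest) = m≼b , m≼a , λ z z≼b z≼a → greatest z z≼a z≼b

  IsInf-of-≼ : ∀ {a b} → a ≼ b → IsInf _∨_ a b a
  IsInf-of-≼ a≼b = ≼-refl , a≼b , λ _ z≼a _ → z≼a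

  IsInf-greatest : ∀ {a b m z} → IsInf _∨_ a b m → z ≼ a → z ≼ b → z ≼ m
  IsInf-greatest (_ , _ , greatest) = greatest _

  ≐-total : ∀ {a} {P : PVal _∨_} → _≐_ _∨_ (⌊_⌋ _∨_ a) P → P a
  ≐-total {a} a≐P = proj₁ (a≐P a) refl

  ≐-⊔ₚ : ∀ {P Q : PVal _∨_} {m y} → _≐_ _∨_ (_⊔ₚ_ _∨_ P y) Q → P m → Q (m ∨ y)
  ≐-⊔ₚ {m = m} {y} P∨y≐Q Pm = proj₁ (P∨y≐Q (m ∨ y)) (m , Pm , refl)

  ≼-along-⊓-≐ : ∀ {a b b'} → _≐_ _∨_ (_⊓_ _∨_ a b) (_⊓_ _∨_ a b') → a ≼ b → a ≼ b'
  ≼-along-⊓-≐ {a} a⊓b≐a⊓b' a≼b = proj₁ (proj₂ (proj₁ (a⊓b≐a⊓b' a) (IsInf-of-≼ a≼b)))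

  module _ (c : A) where

    φ-dist : ∀ {x₁ x₂ x} → φ _∨_ c x₁ x₂ x → IsInf _∨_ (x ∨ x₁) (x ∨ x₂) x
    φ-dist (dist , _) = ≐-total dist

    φ-p₁ : ∀ {x₁ x₂ x} → φ _∨_ c x₁ x₂ x → IsInf _∨_ (x ∨ x₁) (c ∨ x₁) x₁
    φ-p₁ (_ , p₁ , _) = ≐-total p₁

    φ-p₂ : ∀ {x₁ x₂ x} → φ _∨_ c x₁ x₂ x → IsInf _∨_ (x ∨ x₂) (c ∨ x₂) x₂
    φ-p₂ (_ , _ , p₂ , _) = ≐-total p₂

    φ-join : ∀ {x₁ x₂ x} → φ _∨_ c x₁ x₂ x → x₁ ∨ x₂ ≡ x ∨ c
    φ-join (_ , _ , _ , join) = join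

    φ-≼-join : ∀ {x₁ x₂ x} → φ _∨_ c x₁ x₂ x → x ≼ x₁ ∨ x₂
    φ-≼-join {x = x} h = subst (x ≼_) (sym (φ-join h)) (x≼x∨y x c)

    ≼-∨-of-IsInf : ∀ {x y u} → IsInf _∨_ ((x ∨ y) ∨ u) ((c ∨ y) ∨ u) (u ∨ y) →
                   x ≼ (c ∨ y) ∨ u → x ≼ u ∨ y
    ≼-∨-of-IsInf {x} {y} {u} inf x≼ = ≼-trans (≼-trans (x≼x∨y x y) (x≼x∨y (x ∨ y) u))
      (IsInf-greatest inf ≼-refl (∨-least (∨-least x≼ y≼) (y≼x∨y (c ∨ y) u)))
      where
      y≼ : y ≼ (c ∨ y) ∨ u
      y≼ = ≼-trans (y≼x∨y c y) (x≼x∨y (c ∨ y) u)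

    -- u and v are the components of x, u' the matching component of w.
    ≼-component : ∀ {x w u v u'} →
      IsInf _∨_ ((x ∨ (w ∨ u')) ∨ u) ((x ∨ (w ∨ u')) ∨ v) (x ∨ (w ∨ u')) →
      IsInf _∨_ (w ∨ u') (c ∨ u') u' →
      u ≼ u' ∨ c → u ≼ u' ∨ v → x ≼ w → u ≼ u'
    ≼-component {x} {w} {u} {v} {u'} distInf pInf u≼u'∨c u≼u'∨v x≼w =
      IsInf-greatest pInf (≼-trans u≼x∨w∨u' x∨w∨u'≼w∨u') (∨-comm-≼ u≼u'∨c)
      where
      u'≼x∨w∨u' : u' ≼ x ∨ (w ∨ u')
      u'≼x∨w∨u' = ≼-trans (y≼x∨y w u') (y≼x∨y x (w ∨ u'))
      u≼x∨w∨u' : u ≼ x ∨ (w ∨ u')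
      u≼x∨w∨u' = IsInf-greatest distInf (y≼x∨y _ u)
        (≼-trans u≼u'∨v (∨-mono-≼ u'≼x∨w∨u' ≼-refl))
      x∨w∨u'≼w∨u' : x ∨ (w ∨ u') ≼ w ∨ u'
      x∨w∨u'≼w∨u' = ∨-least (≼-trans x≼w (x≼x∨y w u')) ≼-refl

module CDirectSum {A : Set} {_∨_ : Op₂ A} (L : IsJoinSemilattice _≡_ _∨_)
  (c : A) {I₁ I₂ : A → Set} (D : IsCDirectSum _∨_ c I₁ I₂) where

  open JoinSemilatticeOrder L

  Φ : A → A → A → Set
  Φ = φ _∨_ c

  exi : Exi _∨_ c I₁ I₂
  exi = proj₁ (proj₂ (proj₂ (proj₂ D)))

  onto : Onto _∨_ c I₁ I₂
  onto = proj₂ (proj₂ (proj₂ (proj₂ D)))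

  private
    mod1 : Mod1 _∨_ c I₁ I₂
    mod1 = proj₁ D

    mod2 : Mod2 _∨_ c I₁ I₂
    mod2 = proj₁ (proj₂ D)

    abs : Abs _∨_ c I₁ I₂
    abs = proj₁ (proj₂ (proj₂ D))

  module _ {x₁ x₂ x} (i₁ : I₁ x₁) (i₂ : I₂ x₂) (h : Φ x₁ x₂ x) (y : A) where

    dist-∨ : IsInf _∨_ ((x ∨ y) ∨ x₁) ((x ∨ y) ∨ x₂) (x ∨ y)
    dist-∨ = ≐-⊔ₚ (mod1 x y x₁ x₂ i₁ i₂ (≼-reflexive (φ-join c h))) (φ-dist c h)

    p₁-∨ : IsInf _∨_ ((x ∨ y) ∨ x₁) ((c ∨ y) ∨ x₁) (x₁ ∨ y)
    p₁-∨ = ≐-⊔ₚ (proj₁ (mod2 x y x₁ x₂ i₁ i₂ (φ-≼-join c h))) (φ-p₁ c h)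

    p₂-∨ : IsInf _∨_ ((x ∨ y) ∨ x₂) ((c ∨ y) ∨ x₂) (x₂ ∨ y)
    p₂-∨ = ≐-⊔ₚ (proj₂ (mod2 x y x₁ x₂ i₁ i₂ (φ-≼-join c h))) (φ-p₂ c h)

  module _ {x₁ y₁ z₂} (i₁ : I₁ x₁) (j₁ : I₁ y₁) (k₂ : I₂ z₂) where

    ≼∨₂⇒≼∨c : x₁ ≼ y₁ ∨ z₂ → x₁ ≼ y₁ ∨ c
    ≼∨₂⇒≼∨c = ≼-along-⊓-≐ (proj₁ abs x₁ y₁ z₂ i₁ j₁ k₂)

    ≼∨c⇒≼∨₂ : x₁ ≼ y₁ ∨ c → x₁ ≼ y₁ ∨ z₂
    ≼∨c⇒≼∨₂ = ≼-along-⊓-≐ (λ v → swap (proj₁ abs x₁ y₁ z₂ i₁ j₁ k₂ v))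

  module _ {x₂ y₂ z₁} (i₂ : I₂ x₂) (j₂ : I₂ y₂) (k₁ : I₁ z₁) where

    ≼∨₁⇒≼∨c : x₂ ≼ y₂ ∨ z₁ → x₂ ≼ y₂ ∨ c
    ≼∨₁⇒≼∨c = ≼-along-⊓-≐ (proj₂ abs x₂ y₂ z₁ i₂ j₂ k₁)

    ≼∨c⇒≼∨₁ : x₂ ≼ y₂ ∨ c → x₂ ≼ y₂ ∨ z₁
    ≼∨c⇒≼∨₁ = ≼-along-⊓-≐ (λ v → swap (proj₂ abs x₂ y₂ z₁ i₂ j₂ k₁ v))

  module _ {x₁ x₂ x w₁ w₂ w} (i₁ : I₁ x₁) (i₂ : I₂ x₂) (h : Φ x₁ x₂ x)
           (j₁ : I₁ w₁) (j₂ : I₂ w₂) (g : Φ w₁ w₂ w) where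

    φ-monotone : x₁ ≼ w₁ → x₂ ≼ w₂ → x ≼ w
    φ-monotone x₁≼w₁ x₂≼w₂ = IsInf-greatest (φ-dist c g)
      (∨-comm-≼ (≼-trans (below (p₁-∨ i₁ i₂ h w)) (∨-mono-≼ x₁≼w₁ ≼-refl)))
      (∨-comm-≼ (≼-trans (below (p₂-∨ i₁ i₂ h w)) (∨-mono-≼ x₂≼w₂ ≼-refl)))
      where
      x≼w∨c : x ≼ w ∨ c
      x≼w∨c = ≼-trans (φ-≼-join c h)
        (subst (x₁ ∨ x₂ ≼_) (φ-join c g) (∨-mono-≼ x₁≼w₁ x₂≼w₂))
      below : ∀ {u} → IsInf _∨_ ((x ∨ w) ∨ u) ((c ∨ w) ∨ u) (u ∨ w) → x ≼ u ∨ w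
      below {u} inf = ≼-∨-of-IsInf c inf (≼-trans (∨-comm-≼ x≼w∨c) (x≼x∨y (c ∨ w) u))

    φ-reflects : x ≼ w → x₁ ≼ w₁ × x₂ ≼ w₂
    φ-reflects x≼w =
        ≼-component c (dist-∨ i₁ i₂ h (w ∨ w₁)) (φ-p₁ c g)
          x₁≼w₁∨c (≼∨c⇒≼∨₂ i₁ j₁ i₂ x₁≼w₁∨c) x≼w
      , ≼-component c (IsInf-comm (dist-∨ i₁ i₂ h (w ∨ w₂))) (φ-p₂ c g)
          x₂≼w₂∨c (≼∨c⇒≼∨₁ i₂ j₂ i₁ x₂≼w₂∨c) x≼w
      where
      joins : x₁ ∨ x₂ ≼ w₁ ∨ w₂
      joins = subst₂ _≼_ (sym (φ-join c h)) (sym (φ-join c g)) (∨-mono-≼ x≼w ≼-refl)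
      x₁≼w₁∨c : x₁ ≼ w₁ ∨ c
      x₁≼w₁∨c = ≼∨₂⇒≼∨c i₁ j₁ j₂ (≼-trans (x≼x∨y x₁ x₂) joins)
      x₂≼w₂∨c : x₂ ≼ w₂ ∨ c
      x₂≼w₂∨c = ≼∨₁⇒≼∨c i₂ j₂ j₁ (∨-comm-≼ (≼-trans (y≼x∨y x₁ x₂) joins))

  module _ {x₁ x₂ x} (i₁ : I₁ x₁) (i₂ : I₂ x₂) (h : Φ x₁ x₂ x) where

    φ-functional : ∀ {x'} → Φ x₁ x₂ x' → x ≡ x'
    φ-functional h' = ≼-antisym (φ-monotone i₁ i₂ h i₁ i₂ h' ≼-refl ≼-refl)
                                (φ-monotone i₁ i₂ h' i₁ i₂ h ≼-refl ≼-refl)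

    φ-injective : ∀ {w₁ w₂} → I₁ w₁ → I₂ w₂ → Φ w₁ w₂ x → x₁ ≡ w₁ × x₂ ≡ w₂
    φ-injective {w₁} {w₂} j₁ j₂ g =
        ≼-antisym (proj₁ x≼w) (proj₁ w≼x)
      , ≼-antisym (proj₂ x≼w) (proj₂ w≼x)
      where
      x≼w : x₁ ≼ w₁ × x₂ ≼ w₂
      x≼w = φ-reflects i₁ i₂ h j₁ j₂ g ≼-refl
      w≼x : w₁ ≼ x₁ × w₂ ≼ x₂
      w≼x = φ-reflects j₁ j₂ g i₁ i₂ h ≼-refl

    φ-∨ : ∀ {y₁ y₂ y z} → I₁ y₁ → I₂ y₂ → Φ y₁ y₂ y →
          I₁ (x₁ ∨ y₁) → I₂ (x₂ ∨ y₂) → Φ (x₁ ∨ y₁) (x₂ ∨ y₂) z → z ≡ x ∨ y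
    φ-∨ {y₁} {y₂} {y} j₁ j₂ g k₁ k₂ gz with onto (x ∨ y)
    ... | u₁ , u₂ , l₁ , l₂ , gu =
      ≼-antisym
        (φ-monotone k₁ k₂ gz l₁ l₂ gu (∨-least (proj₁ x≼u) (proj₁ y≼u))
                                      (∨-least (proj₂ x≼u) (proj₂ y≼u)))
        (∨-least (φ-monotone i₁ i₂ h k₁ k₂ gz (x≼x∨y x₁ y₁) (x≼x∨y x₂ y₂))
                 (φ-monotone j₁ j₂ g k₁ k₂ gz (y≼x∨y x₁ y₁) (y≼x∨y x₂ y₂)))
      where
      x≼u : x₁ ≼ u₁ × x₂ ≼ u₂
      x≼u = φ-reflects i₁ i₂ h l₁ l₂ gu (x≼x∨y x y)
      y≼u : y₁ ≼ u₁ × y₂ ≼ u₂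
      y≼u = φ-reflects j₁ j₂ g l₁ l₂ gu (y≼x∨y x y)

lemma1 : (A : Set) (_∨_ : Op₂ A) → IsJoinSemilattice (_≡_ {A = A}) _∨_ →
    (c : A) (I₁ I₂ : A → Set) →
    (cl₁ : IsSubsemilattice _∨_ I₁) (cl₂ : IsSubsemilattice _∨_ I₂) →
    IsCDirectSum _∨_ c I₁ I₂ →
    GraphOfIso _∨_ c I₁ I₂ cl₁ cl₂
lemma1 A _∨_ L c I₁ I₂ cl₁ cl₂ D = f , f-graph , f-∨ , f-injective , f-surjective
  where
  open CDirectSum L c D

  P : Set
  P = Prod _∨_ c I₁ I₂

  f : P → A
  f ((x₁ , i₁) , (x₂ , i₂)) = proj₁ (exi x₁ x₂ i₁ i₂)

  φ-f : ∀ p → Φ (proj₁ (proj₁ p)) (proj₁ (proj₂ p)) (f p)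
  φ-f ((x₁ , i₁) , (x₂ , i₂)) = proj₂ (exi x₁ x₂ i₁ i₂)

  f-graph : ∀ p x → Φ (proj₁ (proj₁ p)) (proj₁ (proj₂ p)) x ⇔ (f p ≡ x)
  f-graph p@((_ , i₁) , (_ , i₂)) x =
    mk⇔ (φ-functional i₁ i₂ (φ-f p)) (λ fp≡x → subst (Φ _ _) fp≡x (φ-f p))

  f-∨ : ∀ p q → f (_∨ᴾ_ _∨_ c I₁ I₂ cl₁ cl₂ p q) ≡ f p ∨ f q
  f-∨ p@((_ , i₁) , (_ , i₂)) q@((_ , j₁) , (_ , j₂)) =
    φ-∨ i₁ i₂ (φ-f p) j₁ j₂ (φ-f q) (cl₁ i₁ j₁) (cl₂ i₂ j₂)
        (φ-f (_∨ᴾ_ _∨_ c I₁ I₂ cl₁ cl₂ p q))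

  f-injective : ∀ p q → f p ≡ f q → _≈ᴾ_ _∨_ c I₁ I₂ p q
  f-injective p@((_ , i₁) , (_ , i₂)) q@((_ , j₁) , (_ , j₂)) fp≡fq =
    φ-injective i₁ i₂ (φ-f p) j₁ j₂ (subst (Φ _ _) (sym fp≡fq) (φ-f q))

  f-surjective : ∀ x → Σ[ p ∈ P ] f p ≡ x
  f-surjective x with onto x
  ... | x₁ , x₂ , i₁ , i₂ , h = ((x₁ , i₁) , (x₂ , i₂)) , φ-functional i₁ i₂ (φ-f _) h
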